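{- Let $S$ be a set of finite strings, no one a substring of another, let $c$ be a small cycle of $\mathcal{C}(S)$ (i.e. $o(c)>2w(c)$), and let $s,t$ be strings of $c$ such that $(s,t)$ is not an edge of $c$. Then for every string $t'$ lying on $c$ on the directed path from $s$ to $t$ strictly between them, $\mathrm{dist}(s,t)=\mathrm{dist}(s,t')+\mathrm{dist}(t',t)$.
   Context: For strings $s\neq t$, $\mathrm{ov}(s,t)$ is the longest suffix of $s$ that is a prefix of $t$; $\mathrm{ov}(s,s)$ is the longest suffix of $s$ of length less than $|s|$ that is also a prefix of $s$. $\mathrm{dist}(s,t)=|s|-|\mathrm{ov}(s,t)|$. $\mathcal{C}(S)$ is the cycle cover computed by MGREEDY (fixed tie-breaking): sort all ordered pairs $(s,t)$ of $S$ (including $s=t$) by non-increasing $|\mathrm{ov}(s,t)|$, scan and add $(s,t)$ iff no previously added edge has tail $s$ or head $t$; it is a minimum-length cycle cover of the complete directed graph with self-loops on $S$ with lengths $\mathrm{dist}$. For a cycle $c$: $w(c)$ is the sum of $\mathrm{dist}$ over its edges, and $o(c)$ is $|\mathrm{ov}|$ of its cycle-closing edge (the last edge of $c$ added by MGREEDY). -}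

module Defs where

open import Data.Nat using (ℕ; zero; suc; _+_; _*_; _∸_; _≤_; _<_; NonZero)
open import Data.Nat.DivMod using (_mod_)
open import Data.Bool using (Bool; true; false; if_then_else_; _∨_; _∧_)
open import Data.List using (List; []; _∷_; _++_; [_]; length; take; drop; foldl; map; filter; last; cartesianProduct; allFin; filterᵇ)
open import Data.List.Membership.Propositional using (_∈_)
import Data.Nat as N
open import Relation.Binary.PropositionalEquality using (refl)
open import Data.List.Properties using (≡-dec)
open import Data.Bool.ListAction using (any)
open import Data.Nat.ListAction using (sum)
open import Data.List.Relation.Binary.Permutation.Propositional using (_↭_)
open import Data.List.Relation.Unary.Linked using (Linked)
open import Data.Fin using (Fin)
import Data.Fin as F
open import Data.Fin.Properties using () renaming (_≟_ to _≟F_)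
open import Data.Maybe using (Maybe; just; nothing)
open import Data.Product using (_×_; _,_; proj₁; proj₂; Σ; ∃)
open import Relation.Nullary using (¬_; Dec; yes; no; does)
open import Relation.Nullary.Decidable using (⌊_⌋)
open import Relation.Binary using (DecidableEquality)
open import Relation.Binary.PropositionalEquality using (_≡_; _≢_)

module Strings {A : Set} (_≟_ : DecidableEquality A) where

  String : Set
  String = List A

  _≟S_ : DecidableEquality String
  _≟S_ = ≡-dec _≟_

  Substring : String → String → Set
  Substring s t = Σ String λ u → Σ String λ v → u ++ s ++ v ≡ t

  suffix : ℕ → String → String
  suffix k s = drop (length s ∸ k) s

  prefix : ℕ → String → String
  prefix k t = take k t

  isOvLen : String → String → ℕ → Bool
  isOvLen s t k = ⌊ suffix k s ≟S prefix k t ⌋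

  -- largest k ≤ b with p k (k = 0 always admissible)
  findMax : ℕ → (ℕ → Bool) → ℕ
  findMax zero    p = 0
  findMax (suc k) p = if p (suc k) then suc k else findMax k p

  ovBound : String → String → ℕ
  ovBound s t with does (s ≟S t)
  ... | true  = length s ∸ 1
  ... | false = N._⊓_ (length s) (length t)

  ov : String → String → ℕ
  ov s t = findMax (ovBound s t) (isOvLen s t)

  dist : String → String → ℕ
  dist s t = length s ∸ ov s t

  module Instance {n : ℕ} (S : Fin n → String) where

    Edge : Set
    Edge = Fin n × Fin n

    ovE : Edge → ℕ
    ovE (i , j) = ov (S i) (S j)

    allPairs : List Edge
    allPairs = cartesianProduct (allFin n) (allFin n)

    -- an MGREEDY scanning order: all ordered pairs (incl. self-pairs), each once,
    -- sorted by non-increasing overlap (ties broken arbitrarily but fixed)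
    IsMGreedyOrder : List Edge → Set
    IsMGreedyOrder order = (order ↭ allPairs) × Linked (λ p q → ovE q ≤ ovE p) order

    -- add (i,j) iff no previously added edge has tail i or head j;
    -- edges are kept in order of addition
    step : List Edge → Edge → List Edge
    step acc (i , j) =
      if any (λ e → ⌊ proj₁ e ≟F i ⌋ ∨ ⌊ proj₂ e ≟F j ⌋) acc
      then acc else acc ++ [ (i , j) ]

    mgreedy : List Edge → List Edge
    mgreedy order = foldl step [] order

    -- A cycle given by its vertices cyc 0, ..., cyc m (in cyclic order).
    module Cycle (order : List Edge) {m : ℕ} (cyc : Fin (suc m) → Fin n) where

      at : ℕ → Fin n
      at i = cyc (i mod suc m)

      IsCycleOfC : Set
      IsCycleOfC = (i : Fin (suc m)) → (at (F.toℕ i) , at (suc (F.toℕ i))) ∈ mgreedy order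

      w : ℕ
      w = sum (map (λ i → dist (S (at (F.toℕ i))) (S (at (suc (F.toℕ i))))) (allFin (suc m)))

      isEdgeOfC : Edge → Bool
      isEdgeOfC e = any (λ i → ⌊ e ≟E (at (F.toℕ i) , at (suc (F.toℕ i))) ⌋) (allFin (suc m))
        where
          _≟E_ : DecidableEquality Edge
          (a , b) ≟E (c , d) with a ≟F c | b ≟F d
          ... | yes refl | yes refl = yes refl
          ... | no ne | _ = no λ { refl → ne refl }
          ... | yes _ | no ne = no λ { refl → ne refl }

      -- the cycle-closing edge: last edge of c added by MGREEDY
      closingEdge : Maybe Edge
      closingEdge = last (filterᵇ isEdgeOfC (mgreedy order))

      o : ℕ
      o with closingEdge
      ... | just e  = ovE e
      ... | nothing = 0

{-# OPTIONS --safe #-}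
module Submission where

-- Consecutive strings of a small cycle c overlap by more than 2 w(c), so all its strings are
-- factors of one w-periodic word, the string r steps after b starting at the dist-length of
-- the path from b. Hence dist(s, t) is at most that path length. If it were smaller, the word
-- would have a period p < w and, by Bezout, a period q dividing w. The strings of c then start
-- at distinct residues modulo q, and every string whose successor on c lies farther (mod q) than
-- some other string would make MGREEDY prefer a heavier edge into that string, whose tail is
-- again such a string and strictly longer: an impossible infinite ascent. So dist(s, t) equals
-- the path length, which is additive along the path.

open import Defs
open import Data.Nat using (ℕ; suc; _+_; _*_; _<_)
open import Data.Fin using (Fin)
open import Data.List using (List)
open import Relation.Binary using (DecidableEquality)
open import Relation.Binary.PropositionalEquality using (_≡_; _≢_)
open import Relation.Nullary using (¬_)

open import Data.Bool using (Bool; true; false; T; T?; _∨_)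
open import Data.Bool.ListAction using (any)
open import Data.Bool.Properties using (T-∨)
open import Data.Empty using (⊥-elim)
open import Data.Fin using (toℕ)
open import Data.Fin.Properties using (toℕ-injective; toℕ-fromℕ<) renaming (_≟_ to _≟F_)
open import Data.List
  using ([]; _∷_; _++_; [_]; length; take; drop; last; foldl; map; allFin; tabulate; filterᵇ; filter; upTo)
open import Data.List.Extrema.Nat using (argmin; argmin-all; f[argmin]≤f[xs])
open import Data.List.Membership.Propositional using (_∈_; find; lose)
open import Data.List.Membership.Propositional.Properties
  using (∈-filter⁺; ∈-filter⁻; ∈-upTo⁺; ∈-upTo⁻; ∈-++⁻; ∈-++⁺ˡ; ∈-++⁺ʳ; ∈-allFin; ∈-cartesianProduct⁺)
open import Data.List.Properties using (take++drop≡id; length-take; ++-assoc; ++-identityʳ; map-tabulate)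
open import Data.List.Relation.Binary.Permutation.Propositional using (↭-sym)
open import Data.List.Relation.Binary.Permutation.Propositional.Properties using (∈-resp-↭)
open import Data.List.Relation.Unary.All using (lookup) renaming (_∷_ to _∷ᴬ_; tabulate to tabulateᴬ)
import Data.List.Relation.Unary.All.Properties as All
open import Data.List.Relation.Unary.AllPairs using (AllPairs; _∷_)
import Data.List.Relation.Unary.AllPairs.Properties as AllPairs
open import Data.List.Relation.Unary.Any using (here; there)
open import Data.List.Relation.Unary.Any.Properties using (any⁺; any⁻)
open import Data.List.Relation.Unary.Linked.Properties using (Linked⇒AllPairs)
open import Data.Maybe using (Maybe; just; nothing)
open import Data.Nat using (zero; _≤_; _∸_; _%_; _/_; _⊓_; s≤s; z≤n; _<?_; _≤?_; NonZero; >-nonZero)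
  renaming (_≟_ to _≟ℕ_)
open import Data.Nat.DivMod
open import Data.Nat.Divisibility
  using (_∣_; divides; ∣⇒≤; 0∣⇒≡0; >⇒∤; ∣m+n∣m⇒∣n; n∣m*n; n∣m⇒m%n≡0; m%n≡0⇒n∣m)
open import Data.Nat.GCD using (module Bézout; module GCD)
open import Data.Nat.ListAction using (sum)
open import Data.Nat.Properties
open import Algebra.Properties.CommutativeSemigroup +-commutativeSemigroup using (x∙yz≈y∙xz)
open import Data.Product using (_×_; _,_; proj₁; proj₂; ∃; ∃₂)
open import Data.Sum using (_⊎_; inj₁; inj₂)
import Data.Sum as Sum
open import Function using (_∘_; id; case_of_)
open import Function.Bundles using (Equivalence; _⇔_; mk⇔)
open import Relation.Binary using (Reflexive)
open import Relation.Binary.PropositionalEquality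
  using (refl; sym; trans; cong; cong₂; subst; subst₂; module ≡-Reasoning)
open import Relation.Nullary using (yes; no; ¬?)
open import Relation.Nullary.Decidable using (⌊_⌋; toWitness; fromWitness)

-- Occurrences of lists in sequences

module _ {A : Set} where

  _!?_ : List A → ℕ → Maybe A
  []       !? _     = nothing
  (x ∷ xs) !? zero  = just x
  (x ∷ xs) !? suc i = xs !? i

  !?-injective : ∀ (s t : List A) → (∀ i → s !? i ≡ t !? i) → s ≡ t
  !?-injective []      []      _ = refl
  !?-injective []      (_ ∷ _) h with () ← h 0
  !?-injective (_ ∷ _) []      h with () ← h 0
  !?-injective (x ∷ s) (y ∷ t) h with refl ← h 0 = cong (x ∷_) (!?-injective s t (h ∘ suc))

  drop-!? : ∀ k (s : List A) i → drop k s !? i ≡ s !? (k + i)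
  drop-!? zero    s       i = refl
  drop-!? (suc k) []      i = refl
  drop-!? (suc k) (x ∷ s) i = drop-!? k s i

  take-!?-< : ∀ k (s : List A) i → i < k → take k s !? i ≡ s !? i
  take-!?-< (suc k) []      i       _         = refl
  take-!?-< (suc k) (x ∷ s) zero    _         = refl
  take-!?-< (suc k) (x ∷ s) (suc i) (s≤s i<k) = take-!?-< k s i i<k

  !?-≥length : ∀ (s : List A) i → length s ≤ i → s !? i ≡ nothing
  !?-≥length []      i       _         = refl
  !?-≥length (x ∷ s) (suc i) (s≤s s≤i) = !?-≥length s i s≤i

  take-!?-≥ : ∀ k (s : List A) i → k ≤ i → take k s !? i ≡ nothing
  take-!?-≥ k s i k≤i = !?-≥length (take k s) i
    (≤-trans (≤-reflexive (length-take k s)) (≤-trans (m⊓n≤m k (length s)) k≤i))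

  record OccursAt (W : ℕ → Maybe A) (P : ℕ) (s : List A) : Set where
    constructor occurs
    field
      symbol : ∀ y → y < length s → s !? y ≡ W (P + y)
  open OccursAt public

  occursAt-cong : ∀ {W P P′} {s : List A} → (∀ y → W (P + y) ≡ W (P′ + y)) →
                  OccursAt W P s → OccursAt W P′ s
  occursAt-cong W≡ s-occ = occurs λ y y< → trans (symbol s-occ y y<) (W≡ y)

  nested-occurrence⇒substring : ∀ {W P P′} {s t : List A} →
    OccursAt W P s → OccursAt W P′ t → P ≤ P′ → P′ + length t ≤ P + length s →
    ∃₂ λ u v → u ++ t ++ v ≡ s
  nested-occurrence⇒substring {W} {P} {P′} {s} {t} s-occ t-occ P≤P′ t⊆s =
    take c s , drop (length t) (drop c s) , eq
    where
    open ≡-Reasoning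
    c = P′ ∸ P
    P+c≡P′ : P + c ≡ P′
    P+c≡P′ = m+[n∸m]≡n P≤P′
    c+i<s : ∀ i → i < length t → c + i < length s
    c+i<s i i<t = +-cancelˡ-< P (c + i) (length s)
      (subst (_< P + length s) (trans (cong (_+ i) (sym P+c≡P′)) (+-assoc P c i))
             (<-≤-trans (+-monoʳ-< P′ i<t) t⊆s))
    middle : take (length t) (drop c s) ≡ t
    middle = !?-injective _ _ λ i → case i <? length t of λ where
      (yes i<t) → begin
        take (length t) (drop c s) !? i  ≡⟨ take-!?-< (length t) (drop c s) i i<t ⟩
        drop c s !? i                    ≡⟨ drop-!? c s i ⟩
        s !? (c + i)                     ≡⟨ symbol s-occ (c + i) (c+i<s i i<t) ⟩
        W (P + (c + i))                  ≡⟨ cong W (trans (sym (+-assoc P c i)) (cong (_+ i) P+c≡P′)) ⟩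
        W (P′ + i)                       ≡⟨ sym (symbol t-occ i i<t) ⟩
        t !? i                           ∎
      (no i≮t) → trans (take-!?-≥ (length t) (drop c s) i (≮⇒≥ i≮t))
                       (sym (!?-≥length t i (≮⇒≥ i≮t)))
    eq : take c s ++ t ++ drop (length t) (drop c s) ≡ s
    eq = begin
      take c s ++ t ++ drop (length t) (drop c s)
        ≡⟨ cong (λ z → take c s ++ z ++ drop (length t) (drop c s)) (sym middle) ⟩
      take c s ++ take (length t) (drop c s) ++ drop (length t) (drop c s)
        ≡⟨ cong (take c s ++_) (take++drop≡id (length t) (drop c s)) ⟩
      take c s ++ drop c s
        ≡⟨ take++drop≡id c s ⟩
      s ∎

  module _ {R : A → A → Set} where

    AllPairs-drop : ∀ xs {y ys} → AllPairs R (xs ++ y ∷ ys) → AllPairs R (xs ++ ys)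
    AllPairs-drop []       (_ ∷ ys-pairs)  = ys-pairs
    AllPairs-drop (x ∷ xs) (x-rel ∷ pairs) with xs-rel , _ ∷ᴬ ys-rel ← All.++⁻ xs x-rel =
      All.++⁺ xs-rel ys-rel ∷ AllPairs-drop xs pairs

    AllPairs-++⇒ : ∀ {xs ys x y} → AllPairs R (xs ++ ys) → x ∈ xs → y ∈ ys → R x y
    AllPairs-++⇒ {_ ∷ xs} (x-rel ∷ _) (here refl) y∈ys = lookup (proj₂ (All.++⁻ xs x-rel)) y∈ys
    AllPairs-++⇒ (_ ∷ pairs) (there x∈xs) y∈ys = AllPairs-++⇒ pairs x∈xs y∈ys

    AllPairs-last : Reflexive R → ∀ {xs z x} → AllPairs R xs → last xs ≡ just z → x ∈ xs → R x z
    AllPairs-last refl-R {_ ∷ []}     _             refl (here refl) = refl-R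
    AllPairs-last refl-R {_ ∷ y ∷ ys} (x-rel ∷ _)   eq   (here refl) = lookup x-rel (last∈ (y ∷ ys) eq)
      where
      last∈ : ∀ xs {z} → last xs ≡ just z → z ∈ xs
      last∈ (_ ∷ [])     refl = here refl
      last∈ (_ ∷ y ∷ ys) eq   = there (last∈ (y ∷ ys) eq)
    AllPairs-last refl-R {_ ∷ y ∷ ys} (_ ∷ pairs) eq   (there x∈) = AllPairs-last refl-R pairs eq x∈

  Functional : {C : Set} → (A → C) → List A → Set
  Functional π xs = ∀ {x y} → x ∈ xs → y ∈ xs → π x ≡ π y → x ≡ y

  Functional-∷ʳ : ∀ {C} {π : A → C} {xs x} → Functional π xs → (∀ {y} → y ∈ xs → π y ≢ π x) →
                  Functional π (xs ++ [ x ])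
  Functional-∷ʳ {xs = xs} fun new x∈ y∈ with ∈-++⁻ xs x∈ | ∈-++⁻ xs y∈
  ... | inj₁ x∈xs        | inj₁ y∈xs        = fun x∈xs y∈xs
  ... | inj₂ (here refl) | inj₂ (here refl) = λ _ → refl
  ... | inj₁ x∈xs        | inj₂ (here refl) = ⊥-elim ∘ new x∈xs
  ... | inj₂ (here refl) | inj₁ y∈xs        = ⊥-elim ∘ new y∈xs ∘ sym

-- Residues

module _ (q : ℕ) .{{_ : NonZero q}} where

  %-cong-+ʳ : ∀ {a b} c → a % q ≡ b % q → (a + c) % q ≡ (b + c) % q
  %-cong-+ʳ {a} {b} c eq = begin
    (a + c) % q            ≡⟨ %-distribˡ-+ a c q ⟩
    (a % q + c % q) % q    ≡⟨ cong (λ z → (z + c % q) % q) eq ⟩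
    (b % q + c % q) % q    ≡⟨ %-distribˡ-+ b c q ⟨
    (b + c) % q            ∎
    where open ≡-Reasoning

  %-cong-+ˡ : ∀ a {b c} → b % q ≡ c % q → (a + b) % q ≡ (a + c) % q
  %-cong-+ˡ a {b} {c} eq = begin
    (a + b) % q  ≡⟨ cong (_% q) (+-comm a b) ⟩
    (b + a) % q  ≡⟨ %-cong-+ʳ a eq ⟩
    (c + a) % q  ≡⟨ cong (_% q) (+-comm c a) ⟩
    (a + c) % q  ∎
    where open ≡-Reasoning

  %-cancel-+ : ∀ x d → d < q → (x + d) % q ≡ x % q → d ≡ 0
  %-cancel-+ x zero        _   _  = refl
  %-cancel-+ x d@(suc _) d<q eq =
    ⊥-elim (>⇒∤ d<q (∣m+n∣m⇒∣n (divides ((x + d) / q) multiple) (n∣m*n (x / q))))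
    where
    open ≡-Reasoning
    multiple : x / q * q + d ≡ (x + d) / q * q
    multiple = +-cancelˡ-≡ (x % q) _ _ (begin
      x % q + (x / q * q + d)        ≡⟨ +-assoc (x % q) _ d ⟨
      x % q + x / q * q + d          ≡⟨ cong (_+ d) (m≡m%n+[m/n]*n x q) ⟨
      x + d                          ≡⟨ m≡m%n+[m/n]*n (x + d) q ⟩
      (x + d) % q + (x + d) / q * q  ≡⟨ cong (_+ (x + d) / q * q) eq ⟩
      x % q + (x + d) / q * q        ∎)

  %-cancel-≤ : ∀ a {t t′} → t ≤ t′ → t′ < q → (a + t′) % q ≡ (a + t) % q → t′ ≡ t
  %-cancel-≤ a {t} {t′} t≤t′ t′<q eq = ≤-antisym (m∸n≡0⇒m≤n (%-cancel-+ (a + t) (t′ ∸ t)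
    (≤-<-trans (m∸n≤m t′ t) t′<q)
    (trans (cong (_% q) (trans (+-assoc a t _) (cong (a +_) (m+[n∸m]≡n t≤t′)))) eq))) t≤t′

  +-cancelˡ-% : ∀ a {t t′} → t < q → t′ < q → (a + t) % q ≡ (a + t′) % q → t ≡ t′
  +-cancelˡ-% a {t} {t′} t<q t′<q eq with ≤-total t t′
  ... | inj₁ t≤t′ = sym (%-cancel-≤ a t≤t′ t′<q (sym eq))
  ... | inj₂ t′≤t = %-cancel-≤ a t′≤t t<q eq

  -- the least t with a + t ≡ c (mod q): how far c lies ahead of a on a circle of length q
  gap : ℕ → ℕ → ℕ
  gap a c = (q ∸ a % q + c) % q

  gap<q : ∀ a c → gap a c < q
  gap<q a c = m%n<n _ q

  gap-spec : ∀ a c → (a + gap a c) % q ≡ c % q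
  gap-spec a c = begin
    (a + gap a c) % q              ≡⟨ %-cong-+ʳ (gap a c) (m%n%n≡m%n a q) ⟨
    (a % q + gap a c) % q          ≡⟨ %-cong-+ˡ (a % q) (m%n%n≡m%n (q ∸ a % q + c) q) ⟩
    (a % q + (q ∸ a % q + c)) % q  ≡⟨ cong (_% q) (+-assoc (a % q) _ c) ⟨
    (a % q + (q ∸ a % q) + c) % q  ≡⟨ cong (λ z → (z + c) % q) (m+[n∸m]≡n (m%n≤n a q)) ⟩
    (q + c) % q                    ≡⟨ cong (_% q) (+-comm q c) ⟩
    (c + q) % q                    ≡⟨ [m+n]%n≡m%n c q ⟩
    c % q                          ∎
    where open ≡-Reasoning

  gap-unique : ∀ a c {t} → t < q → (a + t) % q ≡ c % q → t ≡ gap a c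
  gap-unique a c t<q eq = +-cancelˡ-% a t<q (gap<q a c) (trans eq (sym (gap-spec a c)))

  %≡0-between⇒≡ : ∀ {s} → 0 < s → s < q + q → s % q ≡ 0 → s ≡ q
  %≡0-between⇒≡ {s} 0<s s<2q s%q≡0 with m%n≡0⇒n∣m s q s%q≡0
  ... | divides zero          refl = ⊥-elim (<-irrefl refl 0<s)
  ... | divides 1             refl = +-identityʳ q
  ... | divides (suc (suc k)) refl = ⊥-elim (<⇒≱ s<2q (+-monoʳ-≤ q (m≤m+n q (k * q))))

-- Finite sums and ascending chains

sumTo : ℕ → (ℕ → ℕ) → ℕ
sumTo zero    f = 0
sumTo (suc k) f = f 0 + sumTo k (f ∘ suc)

sumTo-cong : ∀ k {f g : ℕ → ℕ} → (∀ j → f j ≡ g j) → sumTo k f ≡ sumTo k g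
sumTo-cong zero    f≗g = refl
sumTo-cong (suc k) f≗g = cong₂ _+_ (f≗g 0) (sumTo-cong k (f≗g ∘ suc))

sum-allFin : ∀ k (f : ℕ → ℕ) → sum (map (f ∘ toℕ) (allFin k)) ≡ sumTo k f
sum-allFin k f = trans (cong sum (map-tabulate {n = k} id (f ∘ toℕ))) (sum-tabulate k f)
  where
  sum-tabulate : ∀ k (f : ℕ → ℕ) → sum (tabulate {n = k} (f ∘ toℕ)) ≡ sumTo k f
  sum-tabulate zero    f = refl
  sum-tabulate (suc k) f = cong (f 0 +_) (sum-tabulate k (f ∘ suc))

term≤sumTo : ∀ k (f : ℕ → ℕ) {r} → r < k → f r ≤ sumTo k f
term≤sumTo (suc k) f {zero}  _         = m≤m+n (f 0) _
term≤sumTo (suc k) f {suc r} (s≤s r<k) = ≤-trans (term≤sumTo k (f ∘ suc) r<k) (m≤n+m _ (f 0))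

threshold-crossing : (f : ℕ → ℕ) {t : ℕ} → ∀ K → f 0 < t → t ≤ f K →
                     ∃ λ i → i < K × f i < t × t ≤ f (suc i)
threshold-crossing f zero    f0<t t≤f0 = ⊥-elim (<⇒≱ f0<t t≤f0)
threshold-crossing f {t} (suc K) f0<t t≤fK+1 with t ≤? f K
... | no  t≰fK = K , ≤-refl , ≰⇒> t≰fK , t≤fK+1
... | yes t≤fK with i , i<K , below , above ← threshold-crossing f K f0<t t≤fK =
  i , m<n⇒m<1+n i<K , below , above

no-unbounded-ascent : ∀ {I : Set} {P : I → Set} (f : I → ℕ) (bound : ℕ) → (∀ {i} → P i → f i ≤ bound) →
                      (∀ {i} → P i → ∃ λ j → P j × f i < f j) → ∀ {i} → ¬ P i
no-unbounded-ascent {P = P} f bound bounded ascend {i} Pi =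
  n≮n bound (≤-trans (m≤m+n (suc bound) (f i)) (climb (suc bound) Pi))
  where
  climb : ∀ k {i} → P i → k + f i ≤ bound
  climb zero    Pi = bounded Pi
  climb (suc k) {i} Pi with j , Pj , fi<fj ← ascend Pi =
    ≤-trans (≤-reflexive (sym (+-suc k (f i)))) (≤-trans (+-monoʳ-≤ k fi<fj) (climb k Pj))

-- Overlaps

module _ {A : Set} (_≟_ : DecidableEquality A) where
  open Strings _≟_

  findMax-satisfies : ∀ b (p : ℕ → Bool) → T (p 0) → T (p (findMax b p))
  findMax-satisfies zero    p p0 = p0
  findMax-satisfies (suc b) p p0 with p (suc b) in eq
  ... | true  = subst T (sym eq) _
  ... | false = findMax-satisfies b p p0

  findMax-≤ : ∀ b (p : ℕ → Bool) → findMax b p ≤ b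
  findMax-≤ zero    p = z≤n
  findMax-≤ (suc b) p with p (suc b)
  ... | true  = ≤-refl
  ... | false = m≤n⇒m≤1+n (findMax-≤ b p)

  findMax-maximal : ∀ b (p : ℕ → Bool) k → k ≤ b → T (p k) → k ≤ findMax b p
  findMax-maximal zero    p zero k≤b pk = z≤n
  findMax-maximal (suc b) p k    k≤b pk with p (suc b) in eq
  ... | true  = k≤b
  ... | false with k ≟ℕ suc b
  ...   | yes refl = ⊥-elim (subst T eq pk)
  ...   | no  k≢   = findMax-maximal b p k (≤-pred (≤∧≢⇒< k≤b k≢)) pk

  Aligned : String → String → ℕ → Set
  Aligned s t K = ∀ i → i < K → s !? (length s ∸ K + i) ≡ t !? i

  suffix≡prefix⇒aligned : ∀ s t K → suffix K s ≡ prefix K t → Aligned s t K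
  suffix≡prefix⇒aligned s t K eq i i<K = begin
    s !? (length s ∸ K + i)       ≡⟨ drop-!? (length s ∸ K) s i ⟨
    drop (length s ∸ K) s !? i    ≡⟨ cong (_!? i) eq ⟩
    take K t !? i                 ≡⟨ take-!?-< K t i i<K ⟩
    t !? i                        ∎
    where open ≡-Reasoning

  aligned⇒suffix≡prefix : ∀ s t K → K ≤ length s → Aligned s t K → suffix K s ≡ prefix K t
  aligned⇒suffix≡prefix s t K K≤s al = !?-injective _ _ λ i →
    trans (drop-!? (length s ∸ K) s i) (case i <? K of λ where
      (yes i<K) → trans (al i i<K) (sym (take-!?-< K t i i<K))
      (no  i≮K) → trans (!?-≥length s _ (s≤s∸K+i (≮⇒≥ i≮K))) (sym (take-!?-≥ K t i (≮⇒≥ i≮K))))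
    where
    s≤s∸K+i : ∀ {i} → K ≤ i → length s ≤ length s ∸ K + i
    s≤s∸K+i K≤i = ≤-trans (≤-reflexive (sym (m∸n+n≡m K≤s))) (+-monoʳ-≤ (length s ∸ K) K≤i)

  ovBound≤ : ∀ s t → ovBound s t ≤ length s × ovBound s t ≤ length t
  ovBound≤ s t with s ≟S t
  ... | yes refl = m∸n≤m (length s) 1 , m∸n≤m (length s) 1
  ... | no  _    = m⊓n≤m (length s) (length t) , m⊓n≤n (length s) (length t)

  ovBound-≢ : ∀ s t → s ≢ t → ovBound s t ≡ length s ⊓ length t
  ovBound-≢ s t s≢t with s ≟S t
  ... | yes s≡t = ⊥-elim (s≢t s≡t)
  ... | no  _   = refl

  ov≤length : ∀ s t → ov s t ≤ length s
  ov≤length s t = ≤-trans (findMax-≤ (ovBound s t) (isOvLen s t)) (proj₁ (ovBound≤ s t))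

  ov≤length′ : ∀ s t → ov s t ≤ length t
  ov≤length′ s t = ≤-trans (findMax-≤ (ovBound s t) (isOvLen s t)) (proj₂ (ovBound≤ s t))

  ov-aligned : ∀ s t → Aligned s t (ov s t)
  ov-aligned s t = suffix≡prefix⇒aligned s t (ov s t)
    (toWitness {a? = suffix (ov s t) s ≟S prefix (ov s t) t}
      (findMax-satisfies (ovBound s t) (isOvLen s t) (fromWitness (drop-length s))))
    where
    drop-length : ∀ (s : String) → drop (length s) s ≡ []
    drop-length []      = refl
    drop-length (_ ∷ s) = drop-length s

  ov-maximal : ∀ s t K → s ≢ t → K ≤ length s → K ≤ length t → Aligned s t K → K ≤ ov s t
  ov-maximal s t K s≢t K≤s K≤t al = findMax-maximal (ovBound s t) (isOvLen s t) K
    (subst (K ≤_) (sym (ovBound-≢ s t s≢t)) (⊓-glb K≤s K≤t))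
    (fromWitness (aligned⇒suffix≡prefix s t K K≤s al))

  dist+ov≡length : ∀ s t → dist s t + ov s t ≡ length s
  dist+ov≡length s t = m∸n+n≡m (ov≤length s t)

  ov-≥-occurrence-offset : ∀ {W P k} {s t : String} → s ≢ t → ¬ Substring t s →
    OccursAt W P s → OccursAt W (P + k) t → k ≤ length s → length s ∸ k ≤ ov s t
  ov-≥-occurrence-offset {W} {P} {k} {s} {t} s≢t t⋢s s-occ t-occ k≤s =
    ov-maximal s t K s≢t (m∸n≤m (length s) k) K≤t aligned
    where
    K = length s ∸ k
    K≤t : K ≤ length t
    K≤t with K ≤? length t
    ... | yes K≤t = K≤t
    ... | no  K≰t = ⊥-elim (t⋢s (nested-occurrence⇒substring s-occ t-occ (m≤m+n P k)
      (begin
        P + k + length t  ≡⟨ +-assoc P k (length t) ⟩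
        P + (k + length t) ≤⟨ +-monoʳ-≤ P (+-monoʳ-≤ k (<⇒≤ (≰⇒> K≰t))) ⟩
        P + (k + K)        ≡⟨ cong (P +_) (m+[n∸m]≡n k≤s) ⟩
        P + length s       ∎)))
      where open ≤-Reasoning
    aligned : Aligned s t K
    aligned i i<K = begin
      s !? (length s ∸ K + i)  ≡⟨ cong (λ z → s !? (z + i)) (m∸[m∸n]≡n k≤s) ⟩
      s !? (k + i)             ≡⟨ symbol s-occ (k + i) k+i<s ⟩
      W (P + (k + i))          ≡⟨ cong W (+-assoc P k i) ⟨
      W (P + k + i)            ≡⟨ symbol t-occ i (<-≤-trans i<K K≤t) ⟨
      t !? i                   ∎
      where
      open ≡-Reasoning
      k+i<s : k + i < length s
      k+i<s = ≤-trans (+-monoʳ-< k i<K) (≤-reflexive (m+[n∸m]≡n k≤s))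

  dist>0 : ∀ s t → ¬ Substring s t → 0 < dist s t
  dist>0 s t s⋢t with ov s t <? length s
  ... | yes ov<s = m<n⇒0<n∸m ov<s
  ... | no  ov≮s = ⊥-elim (s⋢t (nested-occurrence⇒substring {P = 0} {P′ = 0}
          (occurs λ _ _ → refl) s-occ z≤n (≤-trans (≤-reflexive (sym ov≡s)) (ov≤length′ s t))))
    where
    ov≡s : ov s t ≡ length s
    ov≡s = ≤-antisym (ov≤length s t) (≮⇒≥ ov≮s)
    dist≡0 : dist s t ≡ 0
    dist≡0 = trans (cong (length s ∸_) ov≡s) (n∸n≡0 (length s))
    s-occ : OccursAt (t !?_) 0 s
    s-occ = occurs λ y y<s → trans (cong (λ z → s !? (z + y)) (sym dist≡0))
                                   (ov-aligned s t y (subst (y <_) (sym ov≡s) y<s))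

-- The MGREEDY scan

module _ {A : Set} (_≟_ : DecidableEquality A) {n : ℕ} (S : Fin n → Strings.String _≟_) where
  open Strings _≟_
  open Instance S

  Blocks : Edge → Edge → Set
  Blocks e x = proj₁ e ≡ proj₁ x ⊎ proj₂ e ≡ proj₂ x

  _≥ᵒᵛ_ : Edge → Edge → Set
  e ≥ᵒᵛ e′ = ovE e′ ≤ ovE e

  blocking⇔ : ∀ e x → T (⌊ proj₁ e ≟F proj₁ x ⌋ ∨ ⌊ proj₂ e ≟F proj₂ x ⌋) ⇔ Blocks e x
  blocking⇔ e x = mk⇔
    (Sum.map toWitness toWitness ∘ Equivalence.to (T-∨ {⌊ proj₁ e ≟F proj₁ x ⌋}))
    (Equivalence.from (T-∨ {⌊ proj₁ e ≟F proj₁ x ⌋}) ∘ Sum.map fromWitness fromWitness)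

  step-cases : ∀ acc x →
    (step acc x ≡ acc × ∃ λ e → e ∈ acc × Blocks e x) ⊎
    (step acc x ≡ acc ++ [ x ] × ∀ {e} → e ∈ acc → ¬ Blocks e x)
  step-cases acc x@(i , j) with any (λ e → ⌊ proj₁ e ≟F i ⌋ ∨ ⌊ proj₂ e ≟F j ⌋) acc in eq
  ... | true  with e , e∈acc , blocking ← find (any⁻ _ acc (subst T (sym eq) _)) =
    inj₁ (refl , e , e∈acc , Equivalence.to (blocking⇔ e x) blocking)
  ... | false = inj₂ (refl , λ e∈acc blocks →
    subst T eq (any⁺ _ (lose e∈acc (Equivalence.from (blocking⇔ _ x) blocks))))

  step-⊇ : ∀ acc x {e} → e ∈ acc → e ∈ step acc x
  step-⊇ acc x e∈acc with step-cases acc x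
  ... | inj₁ (eq , _) = subst (_ ∈_) (sym eq) e∈acc
  ... | inj₂ (eq , _) = subst (_ ∈_) (sym eq) (∈-++⁺ˡ e∈acc)

  scan-⊇ : ∀ xs acc {e} → e ∈ acc → e ∈ foldl step acc xs
  scan-⊇ []       acc e∈acc = e∈acc
  scan-⊇ (x ∷ xs) acc e∈acc = scan-⊇ xs (step acc x) (step-⊇ acc x e∈acc)

  scan-functional : ∀ {C} (π : Edge → C) → (∀ {e x} → π e ≡ π x → Blocks e x) →
                    ∀ xs acc → Functional π acc → Functional π (foldl step acc xs)
  scan-functional π blocks []       acc fun = fun
  scan-functional π blocks (x ∷ xs) acc fun = scan-functional π blocks xs (step acc x) step-fun
    where
    step-fun : Functional π (step acc x)
    step-fun with step-cases acc x
    ... | inj₁ (eq , _)    rewrite eq = fun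
    ... | inj₂ (eq , free) rewrite eq = Functional-∷ʳ fun (λ e∈acc πe≡πx → free e∈acc (blocks πe≡πx))

  step-sorted : ∀ acc x xs → AllPairs _≥ᵒᵛ_ (acc ++ x ∷ xs) → AllPairs _≥ᵒᵛ_ (step acc x ++ xs)
  step-sorted acc x xs sorted with step-cases acc x
  ... | inj₁ (eq , _) rewrite eq = AllPairs-drop acc sorted
  ... | inj₂ (eq , _) rewrite eq = subst (AllPairs _≥ᵒᵛ_) (sym (++-assoc acc [ x ] xs)) sorted

  scan-sorted : ∀ xs acc → AllPairs _≥ᵒᵛ_ (acc ++ xs) → AllPairs _≥ᵒᵛ_ (foldl step acc xs)
  scan-sorted []       acc sorted = subst (AllPairs _≥ᵒᵛ_) (++-identityʳ acc) sorted
  scan-sorted (x ∷ xs) acc sorted = scan-sorted xs (step acc x) (step-sorted acc x xs sorted)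

  Blocked : List Edge → Edge → Set
  Blocked F x = x ∈ F ⊎ ∃ λ e → e ∈ F × Blocks e x × e ≥ᵒᵛ x

  scan-blocked : ∀ xs acc → AllPairs _≥ᵒᵛ_ (acc ++ xs) → ∀ {x} → x ∈ xs → Blocked (foldl step acc xs) x
  scan-blocked (x ∷ xs) acc sorted (here refl) with step-cases acc x
  ... | inj₁ (_ , e , e∈acc , blocks) =
    inj₂ (e , scan-⊇ xs _ (step-⊇ acc x e∈acc) , blocks , AllPairs-++⇒ sorted e∈acc (here refl))
  ... | inj₂ (eq , _) = inj₁ (scan-⊇ xs _ (subst (x ∈_) (sym eq) (∈-++⁺ʳ acc (here refl))))
  scan-blocked (y ∷ xs) acc sorted (there x∈xs) =
    scan-blocked xs (step acc y) (step-sorted acc y xs sorted) x∈xs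

  module _ {order : List Edge} (mgreedyOrder : IsMGreedyOrder order) where

    order-sorted : AllPairs _≥ᵒᵛ_ order
    order-sorted = Linked⇒AllPairs (λ ov≤ ov≤′ → ≤-trans ov≤′ ov≤) (proj₂ mgreedyOrder)

    mgreedy-sorted : AllPairs _≥ᵒᵛ_ (mgreedy order)
    mgreedy-sorted = scan-sorted order [] order-sorted

    mgreedy-blocked : ∀ x → Blocked (mgreedy order) x
    mgreedy-blocked (i , j) = scan-blocked order [] order-sorted
      (∈-resp-↭ (↭-sym (proj₁ mgreedyOrder)) (∈-cartesianProduct⁺ (∈-allFin i) (∈-allFin j)))

  mgreedy-tails-unique : ∀ order → Functional proj₁ (mgreedy order)
  mgreedy-tails-unique order = scan-functional proj₁ inj₁ order [] λ ()

  mgreedy-heads-unique : ∀ order → Functional proj₂ (mgreedy order)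
  mgreedy-heads-unique order = scan-functional proj₂ inj₂ order [] λ ()

-- Strings along a cycle

module StringCycle {A : Set} (_≟_ : DecidableEquality A) {n : ℕ} (S : Fin n → Strings.String _≟_)
         (substring-free : ∀ i j → i ≢ j → ¬ Strings.Substring _≟_ (S i) (S j))
         {order : List (Strings.Instance.Edge _≟_ S)}
         (mgreedyOrder : Strings.Instance.IsMGreedyOrder _≟_ S order)
         {m : ℕ} (cyc : Fin (suc m) → Fin n) (cyc-injective : ∀ i j → cyc i ≡ cyc j → i ≡ j)
         where
  open Strings _≟_
  open Instance S
  open Cycle order cyc

  N : ℕ
  N = suc m

  cover : List Edge
  cover = mgreedy order

  str : ℕ → String
  str x = S (at x)

  len ovAt distAt : ℕ → ℕ
  len x = length (str x)
  ovAt x = ov (str x) (str (suc x))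
  distAt x = dist (str x) (str (suc x))

  at-mod : ∀ x y → x % N ≡ y % N → at x ≡ at y
  at-mod x y eq = cong cyc (toℕ-injective (trans (toℕ-fromℕ< _) (trans eq (sym (toℕ-fromℕ< _)))))

  at-injective : ∀ x y → at x ≡ at y → x % N ≡ y % N
  at-injective x y eq = trans (sym (toℕ-fromℕ< _)) (trans (cong toℕ (cyc-injective _ _ eq)) (toℕ-fromℕ< _))

  at-offset-injective : ∀ b {r r′} → r < N → r′ < N → at (b + r) ≡ at (b + r′) → r ≡ r′
  at-offset-injective b {r} {r′} r<N r′<N eq = +-cancelˡ-% N b r<N r′<N (at-injective (b + r) (b + r′) eq)

  at-+N : ∀ x → at (x + N) ≡ at x
  at-+N x = at-mod (x + N) x ([m+n]%n≡m%n x N)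

  at-≢⇒str-≢ : ∀ x y → at x ≢ at y → str x ≢ str y
  at-≢⇒str-≢ x y at≢ str≡ = substring-free _ _ at≢ ([] , [] , trans (++-identityʳ _) str≡)

  at-≢⇒¬substring : ∀ x y → at x ≢ at y → ¬ Substring (str x) (str y)
  at-≢⇒¬substring x y = substring-free (at x) (at y)

  cycle-edge : ∀ x → ∃ λ (i : Fin N) → (at (toℕ i) , at (suc (toℕ i))) ≡ (at x , at (suc x))
  cycle-edge x = x mod N , cong₂ _,_ (at-mod (toℕ (x mod N)) x index-%N)
    (at-mod (suc (toℕ (x mod N))) (suc x) (%-cong-+ˡ N 1 {toℕ (x mod N)} {x} index-%N))
    where
    index-%N : toℕ (x mod N) % N ≡ x % N
    index-%N = trans (cong (_% N) (toℕ-fromℕ< (m%n<n x N))) (m%n%n≡m%n x N)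

  distAt+ovAt : ∀ x → distAt x + ovAt x ≡ len x
  distAt+ovAt x = dist+ov≡length _≟_ (str x) (str (suc x))

  distAt-+N : ∀ x → distAt (x + N) ≡ distAt x
  distAt-+N x = cong₂ dist (cong S (at-+N x)) (cong S (at-+N (suc x)))

  pathDist : ℕ → ℕ → ℕ
  pathDist b zero    = 0
  pathDist b (suc r) = distAt b + pathDist (suc b) r

  pathDist-+ : ∀ b j k → pathDist b (j + k) ≡ pathDist b j + pathDist (b + j) k
  pathDist-+ b zero    k = cong (λ z → pathDist z k) (sym (+-identityʳ b))
  pathDist-+ b (suc j) k = begin
    distAt b + pathDist (suc b) (j + k)                       ≡⟨ cong (distAt b +_) (pathDist-+ (suc b) j k) ⟩
    distAt b + (pathDist (suc b) j + pathDist (suc b + j) k)  ≡⟨ +-assoc (distAt b) _ _ ⟨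
    distAt b + pathDist (suc b) j + pathDist (suc b + j) k
      ≡⟨ cong (λ z → distAt b + pathDist (suc b) j + pathDist z k) (+-suc b j) ⟨
    distAt b + pathDist (suc b) j + pathDist (b + suc j) k    ∎
    where open ≡-Reasoning

  pathDist-suc : ∀ b r → pathDist b (suc r) ≡ pathDist b r + distAt (b + r)
  pathDist-suc b r = begin
    pathDist b (suc r)                   ≡⟨ cong (pathDist b) (+-comm 1 r) ⟩
    pathDist b (r + 1)                   ≡⟨ pathDist-+ b r 1 ⟩
    pathDist b r + (distAt (b + r) + 0)  ≡⟨ cong (pathDist b r +_) (+-identityʳ _) ⟩
    pathDist b r + distAt (b + r)        ∎
    where open ≡-Reasoning

  pathDist≡sumTo : ∀ b r → pathDist b r ≡ sumTo r (λ j → distAt (b + j))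
  pathDist≡sumTo b zero    = refl
  pathDist≡sumTo b (suc r) = cong₂ _+_ (cong distAt (sym (+-identityʳ b)))
    (trans (pathDist≡sumTo (suc b) r) (sumTo-cong r (λ j → cong distAt (sym (+-suc b j)))))

  pathDist-around : ∀ b → pathDist b N ≡ w
  pathDist-around zero    = trans (pathDist≡sumTo 0 N) (sym (sum-allFin N distAt))
  pathDist-around (suc b) = trans rotate (pathDist-around b)
    where
    open ≡-Reasoning
    rotate : pathDist (suc b) N ≡ pathDist b N
    rotate = begin
      pathDist (suc b) (suc m)                ≡⟨ pathDist-suc (suc b) m ⟩
      pathDist (suc b) m + distAt (suc b + m) ≡⟨ cong (λ z → pathDist (suc b) m + distAt z) (+-suc b m) ⟨
      pathDist (suc b) m + distAt (b + N)    ≡⟨ cong (pathDist (suc b) m +_) (distAt-+N b) ⟩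
      pathDist (suc b) m + distAt b          ≡⟨ +-comm _ (distAt b) ⟩
      pathDist b N                           ∎

  pathDist-chain : ∀ b r y → pathDist b r + y < len b → str b !? (pathDist b r + y) ≡ str (b + r) !? y
  pathDist-chain b zero    y _ = cong (λ z → str z !? y) (sym (+-identityʳ b))
  pathDist-chain b (suc r) y in-b = begin
    str b !? (distAt b + pathDist (suc b) r + y)  ≡⟨ cong (str b !?_) (+-assoc (distAt b) _ y) ⟩
    str b !? (distAt b + i)                       ≡⟨ ov-aligned _≟_ (str b) (str (suc b)) i i<ov ⟩
    str (suc b) !? i                              ≡⟨ pathDist-chain (suc b) r y
                                                       (<-≤-trans i<ov (ov≤length′ _≟_ (str b) (str (suc b)))) ⟩
    str (suc b + r) !? y                          ≡⟨ cong (λ z → str z !? y) (+-suc b r) ⟨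
    str (b + suc r) !? y                          ∎
    where
    open ≡-Reasoning
    i = pathDist (suc b) r + y
    i<ov : i < ovAt b
    i<ov = +-cancelˡ-< (distAt b) i (ovAt b)
      (subst₂ _<_ (+-assoc (distAt b) _ y) (sym (distAt+ovAt b)) in-b)

  module SmallCycle (cycleOfC : IsCycleOfC) (small : 2 * w < o) (1≤m : 1 ≤ m) where

    cycle-edge∈cover : ∀ x → (at x , at (suc x)) ∈ cover
    cycle-edge∈cover x = let i , eq = cycle-edge x in subst (_∈ cover) eq (cycleOfC i)

    o≤ovAt : ∀ x → o ≤ ovAt x
    o≤ovAt x = let i , eq = cycle-edge x in
      subst (λ e → o ≤ ovE e) eq (o≤ (∈-filter⁺ (T? ∘ isEdgeOfC) (cycleOfC i) (on-cycle i)))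
      where
      o≤ : ∀ {e} → e ∈ filterᵇ isEdgeOfC cover → o ≤ ovE e
      o≤ e∈ with closingEdge in eq
      ... | just _  = AllPairs-last ≤-refl
        (AllPairs.filter⁺ (T? ∘ isEdgeOfC) (mgreedy-sorted _≟_ S mgreedyOrder)) eq e∈
      ... | nothing = z≤n
      on-cycle : ∀ i → T (isEdgeOfC (at (toℕ i) , at (suc (toℕ i))))
      on-cycle i = any⁺ _ (lose (∈-allFin i) (fromWitness refl))

    2w<len : ∀ x → 2 * w < len x
    2w<len x = <-≤-trans small (≤-trans (o≤ovAt x) (ov≤length _≟_ (str x) (str (suc x))))

    w+w<len : ∀ x → w + w < len x
    w+w<len x = subst (_< len x) (cong (w +_) (+-identityʳ w)) (2w<len x)

    at-≢-suc : ∀ x → at x ≢ at (suc x)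
    at-≢-suc x eq with () ← at-offset-injective x {0} {1} (s≤s z≤n) (s≤s 1≤m)
                              (trans (cong at (+-identityʳ x)) (trans eq (cong at (+-comm 1 x))))

    distAt>0 : ∀ x → 0 < distAt x
    distAt>0 x = dist>0 _≟_ (str x) (str (suc x)) (at-≢⇒¬substring x (suc x) (at-≢-suc x))

    w>0 : 0 < w
    w>0 = subst (0 <_) (pathDist-around 0) (≤-trans (distAt>0 0) (m≤m+n _ _))

    instance
      w≢0 : NonZero w
      w≢0 = >-nonZero w>0

    pathDist≤w : ∀ b {r} → r ≤ N → pathDist b r ≤ w
    pathDist≤w b {r} r≤N = begin
      pathDist b r                             ≤⟨ m≤m+n _ _ ⟩
      pathDist b r + pathDist (b + r) (N ∸ r)  ≡⟨ pathDist-+ b r (N ∸ r) ⟨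
      pathDist b (r + (N ∸ r))                 ≡⟨ cong (pathDist b) (m+[n∸m]≡n r≤N) ⟩
      pathDist b N                             ≡⟨ pathDist-around b ⟩
      w                                        ∎
      where open ≤-Reasoning

    pathDist<w : ∀ b {r} → r ≤ m → pathDist b r < w
    pathDist<w b {r} r≤m = begin-strict
      pathDist b r                  <⟨ m<m+n _ (distAt>0 (b + r)) ⟩
      pathDist b r + distAt (b + r) ≡⟨ pathDist-suc b r ⟨
      pathDist b (suc r)            ≤⟨ pathDist≤w b (s≤s r≤m) ⟩
      w                             ∎
      where open ≤-Reasoning

    str-period : ∀ b y → w + y < len b → str b !? (w + y) ≡ str b !? y
    str-period b y in-b = begin
      str b !? (w + y)             ≡⟨ cong (λ z → str b !? (z + y)) (pathDist-around b) ⟨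
      str b !? (pathDist b N + y)  ≡⟨ pathDist-chain b N y
                                        (subst (λ z → z + y < len b) (sym (pathDist-around b)) in-b) ⟩
      str (b + N) !? y             ≡⟨ cong (λ z → S z !? y) (at-+N b) ⟩
      str b !? y                   ∎
      where open ≡-Reasoning

    str-periodic : ∀ b r k → r + k * w < len b → str b !? (r + k * w) ≡ str b !? r
    str-periodic b r zero    _    = cong (str b !?_) (+-identityʳ r)
    str-periodic b r (suc k) in-b = begin
      str b !? (r + (w + k * w))  ≡⟨ cong (str b !?_) (x∙yz≈y∙xz r w (k * w)) ⟩
      str b !? (w + (r + k * w))  ≡⟨ str-period b _ (subst (_< len b) (x∙yz≈y∙xz r w (k * w)) in-b) ⟩
      str b !? (r + k * w)        ≡⟨ str-periodic b r k (≤-<-trans (+-monoʳ-≤ r (m≤n+m (k * w) w)) in-b) ⟩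
      str b !? r                  ∎
      where open ≡-Reasoning

    -- the infinite w-periodic word of which every string of the cycle is a factor
    word : ℕ → ℕ → Maybe A
    word b x = str b !? (x % w)

    str≡word : ∀ b y → y < len b → str b !? y ≡ word b y
    str≡word b y y<len = trans (cong (str b !?_) y≡) (str-periodic b (y % w) (y / w) (subst (_< len b) y≡ y<len))
      where
      y≡ : y ≡ y % w + y / w * w
      y≡ = m≡m%n+[m/n]*n y w

    occurs-in-word : ∀ b r → r ≤ N → OccursAt (word b) (pathDist b r) (str (b + r))
    occurs-in-word b r r≤N = occurs λ y y<len → begin
      str (b + r) !? y                 ≡⟨ str≡word (b + r) y y<len ⟩
      str (b + r) !? (y % w)           ≡⟨ pathDist-chain b r (y % w) in-b ⟨
      str b !? (pathDist b r + y % w)  ≡⟨ str≡word b _ in-b ⟩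
      word b (pathDist b r + y % w)    ≡⟨ cong (str b !?_) (%-cong-+ˡ w (pathDist b r) (m%n%n≡m%n y w)) ⟩
      word b (pathDist b r + y)        ∎
      where
      open ≡-Reasoning
      in-b : ∀ {y} → pathDist b r + y % w < len b
      in-b {y} = <-trans (+-mono-≤-< (pathDist≤w b r≤N) (m%n<n y w)) (w+w<len b)

    HasPeriod : ℕ → ℕ → Set
    HasPeriod b p = ∀ x → word b (x + p) ≡ word b x

    word-period-w : ∀ b → HasPeriod b w
    word-period-w b x = cong (str b !?_) ([m+n]%n≡m%n x w)

    period-* : ∀ {b p} → HasPeriod b p → ∀ c x → word b (x + c * p) ≡ word b x
    period-* {b}     per zero    x = cong (word b) (+-identityʳ x)
    period-* {b} {p} per (suc c) x = begin
      word b (x + (p + c * p))  ≡⟨ cong (word b) (trans (cong (x +_) (+-comm p _)) (sym (+-assoc x _ p))) ⟩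
      word b (x + c * p + p)    ≡⟨ per _ ⟩
      word b (x + c * p)        ≡⟨ period-* {b} per c x ⟩
      word b x                  ∎
      where open ≡-Reasoning

    -- (at x , at y) beats the cycle edge leaving at x, so MGREEDY blocked it
    -- by the cycle edge entering at y
    overlap-beating-cycle-edge : ∀ x y z → at (suc z) ≡ at y → ovAt x < ov (str x) (str y) →
                                 ov (str x) (str y) ≤ ovAt z
    overlap-beating-cycle-edge x y z at-z+1≡ beats with mgreedy-blocked _≟_ S mgreedyOrder (at x , at y)
    ... | inj₁ xy∈cover = ⊥-elim (<-irrefl (sym (cong ovE (mgreedy-tails-unique _≟_ S order
            xy∈cover (cycle-edge∈cover x) refl))) beats)
    ... | inj₂ (e , e∈cover , inj₁ same-tail , e≥xy) = ⊥-elim (<⇒≱ beats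
            (subst (λ e → ovE (at x , at y) ≤ ovE e)
              (mgreedy-tails-unique _≟_ S order e∈cover (cycle-edge∈cover x) same-tail) e≥xy))
    ... | inj₂ (e , e∈cover , inj₂ same-head , e≥xy) = subst (λ e → ovE (at x , at y) ≤ ovE e)
            (mgreedy-heads-unique _≟_ S order e∈cover (cycle-edge∈cover z) (trans same-head (sym at-z+1≡))) e≥xy

    module _ (b q : ℕ) (0<q : 0 < q) (q<w : q < w) (q∣w : q ∣ w) (q-period : HasPeriod b q) where

      instance
        q≢0 : NonZero q
        q≢0 = >-nonZero 0<q

      pos : ℕ → ℕ
      pos = pathDist b

      word-%q : ∀ {x y} → x % q ≡ y % q → word b x ≡ word b y
      word-%q {x} {y} eq = begin
        word b x                    ≡⟨ cong (word b) (m≡m%n+[m/n]*n x q) ⟩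
        word b (x % q + x / q * q)  ≡⟨ period-* {b} q-period (x / q) (x % q) ⟩
        word b (x % q)              ≡⟨ cong (word b) eq ⟩
        word b (y % q)              ≡⟨ period-* {b} q-period (y / q) (y % q) ⟨
        word b (y % q + y / q * q)  ≡⟨ cong (word b) (m≡m%n+[m/n]*n y q) ⟨
        word b y                    ∎
        where open ≡-Reasoning

      occurs-at-residue : ∀ {r a} → r ≤ m → pos r % q ≡ a % q → OccursAt (word b) a (str (b + r))
      occurs-at-residue {r} r≤m eq =
        occursAt-cong (λ y → word-%q (%-cong-+ʳ q y eq)) (occurs-in-word b r (m≤n⇒m≤1+n r≤m))

      at-≢ : ∀ {r r′} → r ≤ m → r′ ≤ m → r ≢ r′ → at (b + r) ≢ at (b + r′)
      at-≢ r≤m r′≤m r≢r′ = r≢r′ ∘ at-offset-injective b (s≤s r≤m) (s≤s r′≤m)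

      same-residue⇒longer : ∀ {r r′} → r ≤ m → r′ ≤ m → r ≢ r′ → pos r % q ≡ pos r′ % q →
                            len (b + r′) < len (b + r)
      same-residue⇒longer {r} {r′} r≤m r′≤m r≢r′ eq = ≰⇒> λ shorter →
        at-≢⇒¬substring (b + r) (b + r′) (at-≢ r≤m r′≤m r≢r′)
        (nested-occurrence⇒substring (occurs-in-word b r′ (m≤n⇒m≤1+n r′≤m)) (occurs-at-residue r≤m eq)
          ≤-refl (+-monoʳ-≤ (pos r′) shorter))

      residues-distinct : ∀ {r r′} → r ≤ m → r′ ≤ m → pos r % q ≡ pos r′ % q → r ≡ r′
      residues-distinct {r} {r′} r≤m r′≤m eq with r ≟ℕ r′
      ... | yes r≡r′ = r≡r′
      ... | no  r≢r′ = ⊥-elim (<-asym (same-residue⇒longer r≤m r′≤m r≢r′ eq)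
                                      (same-residue⇒longer r′≤m r≤m (r≢r′ ∘ sym) (sym eq)))

      ahead : ℕ → ℕ → ℕ
      ahead r r′ = gap q (pos r) (pos r′)

      ahead<q : ∀ r r′ → ahead r r′ < q
      ahead<q r r′ = gap<q q (pos r) (pos r′)

      ahead≤len : ∀ r r′ → ahead r r′ ≤ len (b + r)
      ahead≤len r r′ = <⇒≤ (<-trans (ahead<q r r′) (<-trans q<w (<-trans (m<m+n w w>0) (w+w<len (b + r)))))

      ahead-spec : ∀ r r′ → (pos r + ahead r r′) % q ≡ pos r′ % q
      ahead-spec r r′ = gap-spec q (pos r) (pos r′)

      ahead>0 : ∀ {r r′} → r ≤ m → r′ ≤ m → r ≢ r′ → 0 < ahead r r′
      ahead>0 {r} {r′} r≤m r′≤m r≢r′ = n≢0⇒n>0 λ ahead≡0 → r≢r′ (residues-distinct r≤m r′≤m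
        (trans (cong (_% q) (sym (trans (cong (pos r +_) ahead≡0) (+-identityʳ (pos r))))) (ahead-spec r r′)))

      ahead≤ : ∀ r {j} d → (pos r + d) % q ≡ pos j % q → ahead r j ≤ d
      ahead≤ r {j} d eq = subst (_≤ d)
        (gap-unique q (pos r) (pos j) (m%n<n d q) (trans (%-cong-+ˡ q (pos r) (m%n%n≡m%n d q)) eq))
        (m%n≤m d q)

      ahead-+ : ∀ p i j → ahead p i + ahead i j < q → ahead p j ≡ ahead p i + ahead i j
      ahead-+ p i j <q = sym (gap-unique q (pos p) (pos j) <q (begin
        (pos p + (ahead p i + ahead i j)) % q  ≡⟨ cong (_% q) (+-assoc (pos p) _ _) ⟨
        (pos p + ahead p i + ahead i j) % q    ≡⟨ %-cong-+ʳ q (ahead i j) (ahead-spec p i) ⟩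
        (pos i + ahead i j) % q                ≡⟨ ahead-spec i j ⟩
        pos j % q                              ∎))
        where open ≡-Reasoning

      ahead-there-and-back : ∀ {r r′} → r ≤ m → r′ ≤ m → r ≢ r′ → ahead r r′ + ahead r′ r ≡ q
      ahead-there-and-back {r} {r′} r≤m r′≤m r≢r′ = %≡0-between⇒≡ q
        (≤-trans (ahead>0 r≤m r′≤m r≢r′) (m≤m+n _ _)) (+-mono-< (ahead<q r r′) (ahead<q r′ r))
        (%-cancel-+ q (pos r) _ (m%n<n _ q) (begin
          (pos r + (ahead r r′ + ahead r′ r) % q) % q  ≡⟨ %-cong-+ˡ q (pos r) (m%n%n≡m%n _ q) ⟩
          (pos r + (ahead r r′ + ahead r′ r)) % q      ≡⟨ cong (_% q) (+-assoc (pos r) _ _) ⟨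
          (pos r + ahead r r′ + ahead r′ r) % q        ≡⟨ %-cong-+ʳ q (ahead r′ r) (ahead-spec r r′) ⟩
          (pos r′ + ahead r′ r) % q                    ≡⟨ ahead-spec r′ r ⟩
          pos r % q                                    ∎))
        where open ≡-Reasoning

      prev : ℕ → ℕ
      prev zero    = m
      prev (suc j) = j

      prev≤m : ∀ {j} → j ≤ m → prev j ≤ m
      prev≤m {zero}  _   = ≤-refl
      prev≤m {suc j} j<m = <⇒≤ j<m

      prev≢ : ∀ j → prev j ≢ j
      prev≢ zero    = <⇒≢ 1≤m ∘ sym
      prev≢ (suc j) = <⇒≢ (n<1+n j)

      at-after-prev : ∀ j → at (suc (b + prev j)) ≡ at (b + j)
      at-after-prev zero    = trans (cong at (sym (+-suc b m))) (trans (at-+N b) (cong at (sym (+-identityʳ b))))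
      at-after-prev (suc j) = cong at (sym (+-suc b j))

      pos-after-prev : ∀ j → (pos (prev j) + distAt (b + prev j)) % q ≡ pos j % q
      pos-after-prev zero    = trans (cong (_% q) (trans (sym (pathDist-suc b m)) (pathDist-around b)))
                                     (trans (n∣m⇒m%n≡0 w q q∣w) (sym (m<n⇒m%n≡m 0<q)))
      pos-after-prev (suc j) = cong (_% q) (sym (pathDist-suc b j))

      -- some other string of the cycle starts, modulo q, strictly before the cycle successor of i
      Shortcut : ℕ → Set
      Shortcut i = i ≤ m × ∃ λ j → j ≤ m × j ≢ i × ahead i j < distAt (b + i)

      nearest : ∀ {i} → Shortcut i →
        ∃ λ j → j ≤ m × j ≢ i × ahead i j < distAt (b + i) ×
                (∀ {k} → k ≤ m → k ≢ i → ahead i j ≤ ahead i k)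
      nearest {i} (_ , j₀ , j₀≤m , j₀≢i , short) =
        j , proj₁ j-ok , proj₂ j-ok , ≤-<-trans (minimal j₀≤m j₀≢i) short , minimal
        where
        candidates = filter (λ k → ¬? (k ≟ℕ i)) (upTo N)
        j = argmin (ahead i) j₀ candidates
        j-ok : j ≤ m × j ≢ i
        j-ok = argmin-all (ahead i) (j₀≤m , j₀≢i) (tabulateᴬ λ k∈ →
          let k∈upTo , k≢i = ∈-filter⁻ (λ k → ¬? (k ≟ℕ i)) k∈ in ≤-pred (∈-upTo⁻ k∈upTo) , k≢i)
        minimal : ∀ {k} → k ≤ m → k ≢ i → ahead i j ≤ ahead i k
        minimal k≤m k≢i = lookup (f[argmin]≤f[xs] {f = ahead i} j₀ candidates)
          (∈-filter⁺ (λ k → ¬? (k ≟ℕ i)) (∈-upTo⁺ (s≤s k≤m)) k≢i)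

      overlap-from-ahead : ∀ {i j} → i ≤ m → j ≤ m → j ≢ i →
                           len (b + i) ∸ ahead i j ≤ ov (str (b + i)) (str (b + j))
      overlap-from-ahead {i} {j} i≤m j≤m j≢i = ov-≥-occurrence-offset _≟_
        (at-≢⇒str-≢ (b + i) (b + j) at-i≢at-j) (at-≢⇒¬substring (b + j) (b + i) (at-i≢at-j ∘ sym))
        (occurs-in-word b i (m≤n⇒m≤1+n i≤m)) (occurs-at-residue j≤m (sym (ahead-spec i j)))
        (ahead≤len i j)
        where
        at-i≢at-j = at-≢ i≤m j≤m (j≢i ∘ sym)

      shortcut-beats-cycle-edge : ∀ {i j} → i ≤ m → j ≤ m → j ≢ i → ahead i j < distAt (b + i) →
                                  ovAt (b + i) < ov (str (b + i)) (str (b + j))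
      shortcut-beats-cycle-edge {i} {j} i≤m j≤m j≢i short = begin-strict
        ovAt (b + i)                                    ≡⟨ m+n∸m≡n (distAt (b + i)) (ovAt (b + i)) ⟨
        distAt (b + i) + ovAt (b + i) ∸ distAt (b + i)  ≡⟨ cong (_∸ distAt (b + i)) (distAt+ovAt (b + i)) ⟩
        len (b + i) ∸ distAt (b + i)                    <⟨ ∸-monoʳ-< short distAt≤len ⟩
        len (b + i) ∸ ahead i j                         ≤⟨ overlap-from-ahead i≤m j≤m j≢i ⟩
        ov (str (b + i)) (str (b + j))                  ∎
        where
        open ≤-Reasoning
        distAt≤len : distAt (b + i) ≤ len (b + i)
        distAt≤len = ≤-trans (m≤m+n _ _) (≤-reflexive (distAt+ovAt (b + i)))

      -- the nearest string j gives an overlap beating the cycle edge at i; MGREEDY then forces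
      -- the edge entering j to overlap even more, which makes its tail p a longer shortcut
      shortcut-step : ∀ {i} → Shortcut i → ∃ λ p → Shortcut p × len (b + i) < len (b + p)
      shortcut-step {i} sc@(i≤m , _) with j , j≤m , j≢i , short , minimal ← nearest sc =
        p , (p≤m , i , i≤m , p≢i ∘ sym , ahead-p-i<distAt) , longer
        where
        p = prev j
        p≤m = prev≤m j≤m
        ov-ij = ov (str (b + i)) (str (b + j))
        beats : ovAt (b + i) < ov-ij
        beats = shortcut-beats-cycle-edge i≤m j≤m j≢i short
        p-dominates : ov-ij ≤ ovAt (b + p)
        p-dominates = overlap-beating-cycle-edge (b + i) (b + j) (b + p) (at-after-prev j) beats
        p≢i : p ≢ i
        p≢i p≡i = <⇒≱ beats (subst (λ z → ov-ij ≤ ovAt (b + z)) p≡i p-dominates)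
        nearer : ahead i j < ahead i p
        nearer = ≤∧≢⇒< (minimal p≤m p≢i) λ eq → prev≢ j (sym (residues-distinct j≤m p≤m
          (trans (sym (ahead-spec i j)) (trans (cong (λ t → (pos i + t) % q) eq) (ahead-spec i p)))))
        via-i : ahead p j ≡ ahead p i + ahead i j
        via-i = ahead-+ p i j (subst (ahead p i + ahead i j <_)
          (trans (+-comm (ahead p i) _) (ahead-there-and-back i≤m p≤m (p≢i ∘ sym)))
          (+-monoʳ-< (ahead p i) nearer))
        ahead-p-j≤ : ahead p i + ahead i j ≤ distAt (b + p)
        ahead-p-j≤ = subst (_≤ distAt (b + p)) via-i (ahead≤ p {j} (distAt (b + p)) (pos-after-prev j))
        ahead-p-i<distAt : ahead p i < distAt (b + p)
        ahead-p-i<distAt = <-≤-trans (m<m+n _ (ahead>0 i≤m j≤m (j≢i ∘ sym))) ahead-p-j≤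
        longer : len (b + i) < len (b + p)
        longer = begin-strict
          len (b + i)                                      <⟨ m<m+n _ (ahead>0 p≤m i≤m p≢i) ⟩
          len (b + i) + ahead p i                          ≡⟨ cong (_+ ahead p i) (m∸n+n≡m (ahead≤len i j)) ⟨
          len (b + i) ∸ ahead i j + ahead i j + ahead p i  ≡⟨ +-assoc (len (b + i) ∸ ahead i j) _ _ ⟩
          len (b + i) ∸ ahead i j + (ahead i j + ahead p i)
            ≤⟨ +-mono-≤ (≤-trans (overlap-from-ahead i≤m j≤m j≢i) p-dominates)
                        (≤-trans (≤-reflexive (+-comm (ahead i j) _)) ahead-p-j≤) ⟩
          ovAt (b + p) + distAt (b + p)                    ≡⟨ +-comm (ovAt (b + p)) _ ⟩
          distAt (b + p) + ovAt (b + p)                    ≡⟨ distAt+ovAt (b + p) ⟩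
          len (b + p)                                      ∎
          where open ≤-Reasoning

      no-shortcut : ∀ {i} → ¬ Shortcut i
      no-shortcut = no-unbounded-ascent (λ i → len (b + i)) (sumTo N (λ r → len (b + r)))
        (λ (i≤m , _) → term≤sumTo N (λ r → len (b + r)) (s≤s i≤m)) shortcut-step

      pos-suc≢q : ∀ {r} → r ≤ m → pos (suc r) ≢ q
      pos-suc≢q r≤m pos≡q with m≤n⇒m<n∨m≡n r≤m
      ... | inj₁ r<m  = 1+n≢0 (residues-distinct r<m z≤n
                          (trans (cong (_% q) pos≡q) (trans (n%n≡0 q) (sym (m<n⇒m%n≡m 0<q)))))
      ... | inj₂ refl = <⇒≢ q<w (trans (sym pos≡q) (pathDist-around b))

      crossing⇒shortcut-to-0 : ∀ {r} → suc r ≤ m → pos (suc r) < q → q ≤ pos (suc (suc r)) →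
                               ahead (suc r) 0 < distAt (b + suc r)
      crossing⇒shortcut-to-0 {r} r+1≤m pos<q q≤pos = subst (_< distAt (b + suc r)) ahead≡
        (≰⇒> λ short → pos-suc≢q r+1≤m (≤-antisym (begin
          pos (suc (suc r))                 ≡⟨ pathDist-suc b (suc r) ⟩
          pos (suc r) + distAt (b + suc r)  ≤⟨ +-monoʳ-≤ (pos (suc r)) short ⟩
          pos (suc r) + (q ∸ pos (suc r))   ≡⟨ m+[n∸m]≡n (<⇒≤ pos<q) ⟩
          q                                 ∎) q≤pos))
        where
        open ≤-Reasoning
        pos>0 : 0 < pos (suc r)
        pos>0 = ≤-trans (distAt>0 b) (m≤m+n (distAt b) (pathDist (suc b) r))
        ahead≡ : q ∸ pos (suc r) ≡ ahead (suc r) 0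
        ahead≡ = gap-unique q (pos (suc r)) 0 (∸-monoʳ-< pos>0 (<⇒≤ pos<q))
          (trans (cong (_% q) (m+[n∸m]≡n (<⇒≤ pos<q))) (trans (n%n≡0 q) (sym (m<n⇒m%n≡m 0<q))))

      -- pos climbs from 0 to w > q, so it crosses q; the string just before the crossing
      -- has a shortcut to the string at position 0
      shortcut-exists : ∃ Shortcut
      shortcut-exists with threshold-crossing pos N 0<q (subst (q ≤_) (sym (pathDist-around b)) (<⇒≤ q<w))
      ... | zero , _ , _ , q≤pos1 =
        0 , z≤n , 1 , 1≤m , (λ ()) , <-≤-trans (ahead<q 0 1)
          (subst (q ≤_) (trans (+-identityʳ (distAt b)) (cong distAt (sym (+-identityʳ b)))) q≤pos1)
      ... | suc i , i<N , pos<q , q≤pos =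
        suc i , ≤-pred i<N , 0 , z≤n , (λ ()) , crossing⇒shortcut-to-0 (≤-pred i<N) pos<q q≤pos

    gcd-period : ∀ b {p d} → HasPeriod b p → Bézout.Identity d w p → HasPeriod b d
    gcd-period b {p} {d} p-period (Bézout.+- x y eq) z = begin
      word b (z + d)          ≡⟨ period-* {b} p-period y (z + d) ⟨
      word b (z + d + y * p)  ≡⟨ cong (word b) (trans (+-assoc z d _) (cong (z +_) eq)) ⟩
      word b (z + x * w)      ≡⟨ period-* {b} (word-period-w b) x z ⟩
      word b z                ∎
      where open ≡-Reasoning
    gcd-period b {p} {d} p-period (Bézout.-+ x y eq) z = begin
      word b (z + d)          ≡⟨ period-* {b} (word-period-w b) x (z + d) ⟨
      word b (z + d + x * w)  ≡⟨ cong (word b) (trans (+-assoc z d _) (cong (z +_) eq)) ⟩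
      word b (z + y * p)      ≡⟨ period-* {b} p-period y z ⟩
      word b z                ∎
      where open ≡-Reasoning

    no-period-below-w : ∀ b {p} → 0 < p → p < w → ¬ HasPeriod b p
    no-period-below-w b {p} 0<p p<w p-period with Bézout.result d gcd identity ← Bézout.lemma w p =
      no-shortcut b d 0<d d<w (GCD.gcd∣m gcd) d-period (proj₂ (shortcut-exists b d 0<d d<w (GCD.gcd∣m gcd) d-period))
      where
      d-period = gcd-period b p-period identity
      0<d : 0 < d
      0<d = n≢0⇒n>0 λ d≡0 → <⇒≢ w>0 (sym (0∣⇒≡0 (subst (_∣ w) d≡0 (GCD.gcd∣m gcd))))
      d<w : d < w
      d<w = ≤-<-trans (∣⇒≤ {{>-nonZero 0<p}} (GCD.gcd∣n gcd)) p<w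

    overlap-in-word : ∀ b {e} → e ≤ N → ∀ {i} → i < ov (str b) (str (b + e)) →
                      word b (dist (str b) (str (b + e)) + i) ≡ word b (pathDist b e + i)
    overlap-in-word b {e} e≤N {i} i<ov = begin
      word b (dist (str b) (str (b + e)) + i)  ≡⟨ str≡word b _ in-b ⟨
      str b !? (dist (str b) (str (b + e)) + i) ≡⟨ ov-aligned _≟_ (str b) (str (b + e)) i i<ov ⟩
      str (b + e) !? i                          ≡⟨ symbol (occurs-in-word b e e≤N) i i<len ⟩
      word b (pathDist b e + i)                 ∎
      where
      open ≡-Reasoning
      in-b : dist (str b) (str (b + e)) + i < len b
      in-b = subst (dist (str b) (str (b + e)) + i <_) (dist+ov≡length _≟_ (str b) (str (b + e)))
                   (+-monoʳ-< (dist (str b) (str (b + e))) i<ov)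
      i<len : i < len (b + e)
      i<len = <-≤-trans i<ov (ov≤length′ _≟_ (str b) (str (b + e)))

    window-period⇒period : ∀ b {k p} → k < w → (∀ {x} → k ≤ x → x < len b → word b x ≡ word b (x + p)) →
                           HasPeriod b p
    window-period⇒period b {k} {p} k<w window x = begin
      word b (x + p)   ≡⟨ cong (str b !?_) (%-cong-+ʳ w p x′≡x) ⟨
      word b (x′ + p)  ≡⟨ window (≤-trans (<⇒≤ k<w) (m≤n+m w (x % w)))
                                 (<-trans (+-monoˡ-< w (m%n<n x w)) (w+w<len b)) ⟨
      word b x′        ≡⟨ cong (str b !?_) x′≡x ⟩
      word b x         ∎
      where
      open ≡-Reasoning
      x′ = x % w + w
      x′≡x : x′ % w ≡ x % w
      x′≡x = trans ([m+n]%n≡m%n (x % w) w) (m%n%n≡m%n x w)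

    dist-along-path : ∀ b {e} → 1 ≤ e → e ≤ m → dist (str b) (str (b + e)) ≡ pathDist b e
    dist-along-path b {e} 1≤e e≤m = ≤-antisym dist≤ (≮⇒≥ λ dist<P →
        no-period-below-w b (m<n⇒0<n∸m dist<P) (≤-<-trans (m∸n≤m P k) (pathDist<w b e≤m))
          (window-period⇒period b (<-trans dist<P (pathDist<w b e≤m)) (shift dist<P)))
      where
      P = pathDist b e
      k = dist (str b) (str (b + e))
      P≤len : P ≤ len b
      P≤len = <⇒≤ (<-trans (pathDist<w b e≤m) (<-trans (m<m+n w w>0) (w+w<len b)))
      at-b≢at-b+e : at b ≢ at (b + e)
      at-b≢at-b+e eq =
        <⇒≢ 1≤e (at-offset-injective b (s≤s z≤n) (s≤s e≤m) (trans (cong at (+-identityʳ b)) eq))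
      dist≤ : k ≤ P
      dist≤ = begin
        len b ∸ ov (str b) (str (b + e))  ≤⟨ ∸-monoʳ-≤ (len b) (ov-≥-occurrence-offset _≟_
          (at-≢⇒str-≢ b (b + e) at-b≢at-b+e) (at-≢⇒¬substring (b + e) b (at-b≢at-b+e ∘ sym))
          (occurs (str≡word b)) (occurs-in-word b e (m≤n⇒m≤1+n e≤m)) P≤len) ⟩
        len b ∸ (len b ∸ P)               ≡⟨ m∸[m∸n]≡n P≤len ⟩
        P                                 ∎
        where open ≤-Reasoning
      shift : k < P → ∀ {x} → k ≤ x → x < len b → word b x ≡ word b (x + (P ∸ k))
      shift k<P {x} k≤x x<len = begin
        word b x              ≡⟨ cong (word b) (m+[n∸m]≡n k≤x) ⟨
        word b (k + (x ∸ k))  ≡⟨ overlap-in-word b (m≤n⇒m≤1+n e≤m) x∸k<ov ⟩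
        word b (P + (x ∸ k))  ≡⟨ cong (word b) P+[x∸k]≡x+[P∸k] ⟩
        word b (x + (P ∸ k))  ∎
        where
        open ≡-Reasoning
        x∸k<ov : x ∸ k < ov (str b) (str (b + e))
        x∸k<ov = +-cancelˡ-< k (x ∸ k) _
          (subst₂ _<_ (sym (m+[n∸m]≡n k≤x)) (sym (dist+ov≡length _≟_ (str b) (str (b + e)))) x<len)
        P+[x∸k]≡x+[P∸k] : P + (x ∸ k) ≡ x + (P ∸ k)
        P+[x∸k]≡x+[P∸k] = begin
          P + (x ∸ k)  ≡⟨ +-∸-assoc P k≤x ⟨
          P + x ∸ k    ≡⟨ cong (_∸ k) (+-comm P x) ⟩
          x + P ∸ k    ≡⟨ +-∸-assoc x (<⇒≤ k<P) ⟩
          x + (P ∸ k)  ∎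

lemma8 : {A : Set} (_≟_ : DecidableEquality A) →
    let open Strings _≟_ in
    (n : ℕ) (S : Fin n → String) →
    -- no string of S is a substring of another
    (∀ i j → i ≢ j → ¬ Substring (S i) (S j)) →
    let open Instance S in
    -- an MGREEDY scan order (fixed tie-breaking)
    (order : List Edge) → IsMGreedyOrder order →
    -- c : a cycle of C(S) with vertices cyc 0, ..., cyc m in cyclic order
    (m : ℕ) (cyc : Fin (suc m) → Fin n) →
    (∀ i j → cyc i ≡ cyc j → i ≡ j) →
    let open Cycle order cyc in
    IsCycleOfC →
    -- c is small
    2 * w < o →
    -- s = at a, t = at (a + d), with s ≠ t and (s,t) not an edge of c
    (a d : ℕ) → a < suc m → 1 < d → d < suc m →
    -- t' = at (a + j) strictly between s and t on the path from s to t
    (j : ℕ) → 0 < j → j < d →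
    dist (S (at a)) (S (at (a + d)))
      ≡ dist (S (at a)) (S (at (a + j))) + dist (S (at (a + j))) (S (at (a + d)))
lemma8 _≟_ n S substring-free order mgreedyOrder m cyc cyc-injective cycleOfC small a d _ 1<d d<N j 0<j j<d =
  begin
    dist (str a) (str (a + d))                ≡⟨ dist-along-path a (<⇒≤ 1<d) d≤m ⟩
    pathDist a d                              ≡⟨ cong (pathDist a) (m+[n∸m]≡n j≤d) ⟨
    pathDist a (j + (d ∸ j))                  ≡⟨ pathDist-+ a j (d ∸ j) ⟩
    pathDist a j + pathDist (a + j) (d ∸ j)   ≡⟨ cong₂ _+_ (dist-along-path a 0<j (≤-trans j≤d d≤m))
                                                  (dist-along-path (a + j) (m<n⇒0<n∸m j<d) (≤-trans (m∸n≤m d j) d≤m)) ⟨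
    dist (str a) (str (a + j)) + dist (str (a + j)) (str (a + j + (d ∸ j)))
      ≡⟨ cong (λ z → dist (str a) (str (a + j)) + dist (str (a + j)) (str z))
              (trans (+-assoc a j (d ∸ j)) (cong (a +_) (m+[n∸m]≡n j≤d))) ⟩
    dist (str a) (str (a + j)) + dist (str (a + j)) (str (a + d)) ∎
  where
  open ≡-Reasoning
  open Strings _≟_
  open StringCycle _≟_ S substring-free mgreedyOrder cyc cyc-injective
  d≤m = ≤-pred d<N
  j≤d = <⇒≤ j<d
  open SmallCycle cycleOfC small (≤-trans (<⇒≤ 1<d) d≤m)
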